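{- Let $n>1$, $1<k\le\binom{n-1}{\lfloor(n-1)/2\rfloor}$, let $\mathcal{FB}_{n,k}$ be a standard full NGBW, and let $\langle f,g\rangle$ be a PGCL-ranking for it. Then the word $seg_{f,g}$ (defined below) is a GC-segment of $\mathcal{FB}_{n,k}$, i.e. $seg_{f,g}^\omega\notin\mathcal{L}(\mathcal{FB}_{n,k})$.
   Context: A standard full NGBW $\mathcal{FB}_{n,k}=(\Sigma_n,S_n,I_n,\Delta_n,\{F_1,\dots,F_k\})$: $|S_n|=n$, $I_n=S_n$, $\Sigma_n=\mathcal{P}(S_n\times S_n)$, $\langle p,a,q\rangle\in\Delta_n$ iff $\langle p,q\rangle\in a$; a fixed state $s_{nf}$, $S'_n=S_n\setminus\{s_{nf}\}$; $F_1,\dots,F_k$ are pairwise distinct subsets of $S'_n$ of size $\lfloor(n-1)/2\rfloor$ with every $q\in S'_n$ outside at least $\lfloor k/2\rfloor$ of them. A run over $\alpha\in\Sigma_n^\omega$ is $\rho(0)\rho(1)\cdots$ with $\rho(0)\in I_n$, $\langle\rho(i),\alpha(i),\rho(i+1)\rangle\in\Delta_n$; it is successful if each $F_i$ contains a state occurring infinitely often; $\mathcal{L}(\mathcal{FB}_{n,k})$ is the set of $\omega$-words with a successful run. A PGCL-ranking is $\langle f,g\rangle$ with $f:S'_n\to\{1,\dots,n-1\}$ bijective and $g:S'_n\to\{1,\dots,k\}$ with $q\notin F_{g(q)}$ for all $q$. Construction of $seg_{f,g}$: for sets $A,R\subseteq S_n\times S_n$ let $[+A,-R]$ denote the letter $(\{\langle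 q,q\rangle:q\in S'_n\}\cup A)\setminus R$. For each $i\in\{1,\dots,k\}$ and $p\in S'_n$ with $i\ne g(p)$ fix an element $c(i,p)\in F_i\setminus F_{g(p)}$. For $r\in\{1,\dots,n-1\}$ with $p=f^{ -1}(r)$, let $u_r$ be the concatenation, over $i\in\{1,\dots,k\}\setminus\{g(p)\}$ in increasing order, of the two-letter words $[+\{\langle p,s\rangle,\langle s,s_{nf}\rangle\},-\{\langle p,p\rangle,\langle s,s\rangle\}]\cdot[+\{\langle s,p\rangle,\langle s_{nf},s\rangle\},-\{\langle p,p\rangle,\langle s,s\rangle\}]$ where $s=c(i,p)$. For $r\in\{2,\dots,n-1\}$ with $p=f^{ -1}(r)$, $q=f^{ -1}(r-1)$ and $s$ a fixed element of $F_{g(p)}$, let $v_r=[+\{\langle p,s\rangle,\langle s,s_{nf}\rangle\},-\{\langle s,s\rangle\}]\cdot[+\{\langle s,q\rangle,\langle s_{nf},s\rangle\},-\{\langle s,s\rangle\}]$. Then $seg_{f,g}=u_{n-1}v_{n-1}u_{n-2}v_{n-2}\cdots u_2v_2u_1$. -}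

module Defs where

open import Data.Bool using (Bool; true; false; _∧_; _∨_; not)
open import Data.Nat using (ℕ; zero; suc; _≤_; _<_; _∸_; _/_)
open import Data.Nat.DivMod using (_mod_)
open import Data.Nat.Combinatorics using (_C_)
open import Data.Fin using (Fin; _≟_)
open import Data.Fin.Subset using (Subset; _∈_; _∉_; ∣_∣)
open import Data.Fin.Subset.Properties using (_∈?_)
open import Data.List using (List; []; _∷_; _++_; length; lookup; filter; concatMap; allFin)
open import Data.Bool.ListAction using (any)
open import Data.Product using (_×_; _,_; ∃; Σ)
open import Relation.Nullary using (¬_)
open import Relation.Nullary.Decidable using (⌊_⌋; ¬?)
open import Relation.Binary.PropositionalEquality using (_≡_; _≢_)

-- States of FB_{n,k} are Fin n.
-- A letter is a binary relation on states, i.e. an element of P(S × S),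
-- represented by its (Boolean) characteristic function.
Letter : ℕ → Set
Letter n = Fin n → Fin n → Bool

Δ : ∀ {n} → Fin n → Letter n → Fin n → Set
Δ p a q = a p q ≡ true

ωWord : ℕ → Set
ωWord n = ℕ → Letter n

-- A run over α (I_n = S_n, so no constraint on ρ 0).
IsRun : ∀ {n} → ωWord n → (ℕ → Fin n) → Set
IsRun α ρ = ∀ i → Δ (ρ i) (α i) (ρ (suc i))

InfOften : ∀ {n} → (ℕ → Fin n) → Fin n → Set
InfOften ρ q = ∀ N → ∃ λ m → N ≤ m × ρ m ≡ q

Successful : ∀ {n k} → (Fin k → Subset n) → (ℕ → Fin n) → Set
Successful {n} F ρ = ∀ i → ∃ λ (q : Fin n) → q ∈ F i × InfOften ρ q

Accepts : ∀ {n k} → (Fin k → Subset n) → ωWord n → Set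
Accepts F α = ∃ λ ρ → IsRun α ρ × Successful F ρ

-- w^ω for a finite word w (the empty word is mapped to an arbitrary letter;
-- never used for the nonempty seg_{f,g})
_^ω : ∀ {n} → List (Letter n) → ωWord n
([] ^ω) m = λ _ _ → false
((x ∷ xs) ^ω) m = lookup (x ∷ xs) (m mod suc (length xs))

countOutside : ∀ {n k} → (Fin k → Subset n) → Fin n → ℕ
countOutside {k = k} F q = length (filter (λ i → ¬? (q ∈? F i)) (allFin k))

IsStandardFull : (n k : ℕ) → Fin n → (Fin k → Subset n) → Set
IsStandardFull n k snf F =
    (∀ i j → i ≢ j → F i ≢ F j)
  × (∀ i → snf ∉ F i)
  × (∀ i → ∣ F i ∣ ≡ (n ∸ 1) / 2)
  × (∀ q → q ≢ snf → k / 2 ≤ countOutside F q)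

-- PGCL-ranking ⟨f,g⟩ (f and g only matter on S'_n = S_n ∖ {snf})
IsPGCL : (n k : ℕ) → Fin n → (Fin k → Subset n) → (Fin n → ℕ) → (Fin n → Fin k) → Set
IsPGCL n k snf F f g =
    (∀ q → q ≢ snf → 1 ≤ f q × f q ≤ n ∸ 1)
  × (∀ p q → p ≢ snf → q ≢ snf → f p ≡ f q → p ≡ q)
  × (∀ r → 1 ≤ r → r ≤ n ∸ 1 → ∃ λ q → q ≢ snf × f q ≡ r)
  × (∀ q → q ≢ snf → q ∉ F (g q))

-- Construction of seg_{f,g}.
-- finv is f^{-1} on {1,…,n-1}; c i p is the chosen c(i,p) ∈ F_i ∖ F_{g(p)};
-- d p is the fixed element of F_{g(p)} used in v_r (p = f^{-1}(r)).
module Construction {n k : ℕ} (snf : Fin n) (g : Fin n → Fin k)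
                    (finv : ℕ → Fin n) (c : Fin k → Fin n → Fin n) (d : Fin n → Fin n) where

  inPairs : List (Fin n × Fin n) → Fin n → Fin n → Bool
  inPairs A p q = any (λ { (a , b) → ⌊ a ≟ p ⌋ ∧ ⌊ b ≟ q ⌋ }) A

  [+_,-_] : List (Fin n × Fin n) → List (Fin n × Fin n) → Letter n
  [+ A ,- R ] p q = ((⌊ p ≟ q ⌋ ∧ not ⌊ p ≟ snf ⌋) ∨ inPairs A p q) ∧ not (inPairs R p q)

  uPart : Fin n → Fin k → List (Letter n)
  uPart p i with i ≟ g p
  ... | Relation.Nullary.yes _ = []
  ... | Relation.Nullary.no _ =
        let s = c i p in
        [+ (p , s) ∷ (s , snf) ∷ [] ,- (p , p) ∷ (s , s) ∷ [] ]
        ∷ [+ (s , p) ∷ (snf , s) ∷ [] ,- (p , p) ∷ (s , s) ∷ [] ]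
        ∷ []

  u : ℕ → List (Letter n)
  u r = concatMap (uPart (finv r)) (allFin k)

  v : ℕ → List (Letter n)
  v r = let p = finv r ; q = finv (r ∸ 1) ; s = d p in
        [+ (p , s) ∷ (s , snf) ∷ [] ,- (s , s) ∷ [] ]
        ∷ [+ (s , q) ∷ (snf , s) ∷ [] ,- (s , s) ∷ [] ]
        ∷ []

  segFrom : ℕ → List (Letter n)
  segFrom zero = []
  segFrom (suc zero) = u 1
  segFrom (suc (suc r)) = u (suc (suc r)) ++ v (suc (suc r)) ++ segFrom (suc r)

  seg : List (Letter n)
  seg = segFrom (n ∸ 1)

-- Read seg_{f,g} as a sequence of letter pairs: every u-block and every v-block
-- consists of two-letter words.  Both kinds of pairs are "detours": a path
-- x → y → z through such a pair either comes back to its start (z = x) having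
-- only visited x, the non-final state snf, or (for u-pairs) c(i,x) — states
-- outside F_{g(x)} — or it moves from f⁻¹(r) down to f⁻¹(r-1), decreasing
-- the rank f (v-pairs).  Hence on any run over seg^ω the states at even
-- positions never increase in rank, so the run is eventually constant at
-- some x at even positions, and from then on it never visits F_{g(x)}: the
-- run is not successful.
module Submission where

open import Defs
open import Data.Bool using (T; not; _∧_; _∨_)
open import Data.Bool.Properties using (T-≡; T-∧; T-∨)
open import Data.Empty using (⊥; ⊥-elim)
open import Data.Fin using (Fin; zero; suc; toℕ; _≟_)
open import Data.Fin.Properties using (toℕ-fromℕ<)
open import Data.Fin.Subset using (Subset; _∈_; _∉_)
open import Data.List using (List; []; _∷_; _++_; length; lookup; concatMap; allFin)
open import Data.List.Membership.Propositional using () renaming (_∈_ to _∈ₗ_; _∉_ to _∉ₗ_)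
open import Data.List.Relation.Unary.Any using (here; there)
open import Data.Nat using (ℕ; zero; suc; _≤_; _<_; _∸_; _+_; _*_; _%_; _/_; s≤s; z≤n)
open import Data.Nat.Combinatorics using (_C_)
open import Data.Nat.DivMod using (_mod_; %-congʳ; m%n*o≡m*o%[n*o]; [m*n+o]%[p*n]≡[m*n]%[p*n]+o)
open import Data.Nat.Properties
  using (suc-injective; ≤-refl; <-≤-trans; <-irrefl; n<1+n; m≤n⇒m≤1+n; <⇒≤; m∸n+n≡m; +-comm)
open import Data.Product using (_×_; _,_; ∃; proj₁; proj₂)
open import Data.Sum using (_⊎_; inj₁; inj₂)
import Data.Sum as Sum
open import Function using (_∘_; Equivalence)
open import Relation.Nullary using (¬_; yes; no)
open import Relation.Nullary.Decidable using (⌊_⌋; toWitness; fromWitness; toWitnessFalse)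
open import Relation.Binary.PropositionalEquality
  using (_≡_; _≢_; refl; sym; trans; cong; cong₂; subst; subst₂; module ≡-Reasoning)

open Equivalence using (to; from)

module LetterShape {n k : ℕ} (snf : Fin n) (g : Fin n → Fin k)
                   (finv : ℕ → Fin n) (c : Fin k → Fin n → Fin n) (d : Fin n → Fin n) where
  open Construction snf g finv c d

  inPairs-sound : ∀ A {x y} → T (inPairs A x y) → (x , y) ∈ₗ A
  inPairs-sound ((a , b) ∷ A) {x} {y} t with to (T-∨ {⌊ a ≟ x ⌋ ∧ ⌊ b ≟ y ⌋}) t
  ... | inj₁ hit = let (a≡x , b≡y) = to (T-∧ {⌊ a ≟ x ⌋}) hit
                   in here (sym (cong₂ _,_ (toWitness a≡x) (toWitness b≡y)))
  ... | inj₂ rest = there (inPairs-sound A rest)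

  inPairs-complete : ∀ A {x y} → (x , y) ∈ₗ A → T (inPairs A x y)
  inPairs-complete ((a , b) ∷ _) (here refl) =
    from (T-∨ {⌊ a ≟ a ⌋ ∧ ⌊ b ≟ b ⌋})
         (inj₁ (from (T-∧ {⌊ a ≟ a ⌋}) (fromWitness {a? = a ≟ a} refl , fromWitness {a? = b ≟ b} refl)))
  inPairs-complete ((a , b) ∷ A) {x} {y} (there m) =
    from (T-∨ {⌊ a ≟ x ⌋ ∧ ⌊ b ≟ y ⌋}) (inj₂ (inPairs-complete A m))

  edge : ∀ A R {x y} → Δ x [+ A ,- R ] y → ((x ≡ y × x ≢ snf) ⊎ (x , y) ∈ₗ A) × (x , y) ∉ₗ R
  edge A R {x} {y} e with to (T-∧ {(⌊ x ≟ y ⌋ ∧ not ⌊ x ≟ snf ⌋) ∨ inPairs A x y}) (from T-≡ e)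
  ... | kept , unremoved = loop-or-added , not-removed
    where
    not-removed : (x , y) ∉ₗ R
    not-removed m = subst (T ∘ not) (to T-≡ (inPairs-complete R m)) unremoved
    loop-or-added : (x ≡ y × x ≢ snf) ⊎ (x , y) ∈ₗ A
    loop-or-added with to (T-∨ {⌊ x ≟ y ⌋ ∧ not ⌊ x ≟ snf ⌋}) kept
    ... | inj₁ loop = let (x≡y , x≢snf) = to (T-∧ {⌊ x ≟ y ⌋}) loop
                      in inj₁ (toWitness x≡y , toWitnessFalse x≢snf)
    ... | inj₂ added = inj₂ (inPairs-sound A added)

  -- Every u- and v-pair has the shape [+{⟨p,s⟩,⟨s,snf⟩},-R₁]·[+{⟨s,q⟩,⟨snf,s⟩},-R₂]
  -- with ⟨s,s⟩ removed in both letters.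
  detour : ∀ {p s q} R₁ R₂ → s ≢ snf → (s , s) ∈ₗ R₁ → (s , s) ∈ₗ R₂ → ∀ {x y z}
    → Δ x [+ (p , s) ∷ (s , snf) ∷ [] ,- R₁ ] y
    → Δ y [+ (s , q) ∷ (snf , s) ∷ [] ,- R₂ ] z
    → (x ≡ p × y ≡ s × z ≡ q) ⊎ (z ≡ x × (y ≡ x ⊎ y ≡ snf))
  detour {p} {s} {q} R₁ R₂ s≢snf ss∈R₁ ss∈R₂ e₁ e₂
    with edge ((p , s) ∷ (s , snf) ∷ []) R₁ e₁ | edge ((s , q) ∷ (snf , s) ∷ []) R₂ e₂
  ... | inj₁ (refl , _) , _          | inj₁ (refl , _) , _          = inj₂ (refl , inj₁ refl)
  ... | inj₁ (refl , _) , ss∉R₁      | inj₂ (here refl) , _         = ⊥-elim (ss∉R₁ ss∈R₁)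
  ... | inj₁ (refl , x≢snf) , _      | inj₂ (there (here refl)) , _ = ⊥-elim (x≢snf refl)
  ... | inj₂ (here refl) , _         | inj₁ (refl , _) , ss∉R₂      = ⊥-elim (ss∉R₂ ss∈R₂)
  ... | inj₂ (here refl) , _         | inj₂ (here refl) , _         = inj₁ (refl , refl , refl)
  ... | inj₂ (here refl) , _         | inj₂ (there (here refl)) , _ = ⊥-elim (s≢snf refl)
  ... | inj₂ (there (here refl)) , _ | inj₁ (refl , snf≢snf) , _    = ⊥-elim (snf≢snf refl)
  ... | inj₂ (there (here refl)) , _ | inj₂ (here refl) , _         = ⊥-elim (s≢snf refl)
  ... | inj₂ (there (here refl)) , _ | inj₂ (there (here refl)) , _ = inj₂ (refl , inj₂ refl)

data Paired {A : Set} (G : A → A → Set) : List A → Set where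
  []  : Paired G []
  _∷_ : ∀ {a b w} → G a b → Paired G w → Paired G (a ∷ b ∷ w)

module _ {A : Set} {G : A → A → Set} where

  paired-++ : ∀ {w w′} → Paired G w → Paired G w′ → Paired G (w ++ w′)
  paired-++ []         pw′ = pw′
  paired-++ (gab ∷ pw) pw′ = gab ∷ paired-++ pw pw′

  paired-concatMap : ∀ {B : Set} {h : B → List A}
    → (∀ b → Paired G (h b)) → ∀ bs → Paired G (concatMap h bs)
  paired-concatMap ph []       = []
  paired-concatMap ph (b ∷ bs) = paired-++ (ph b) (paired-concatMap ph bs)

  paired-length : ∀ {w} → Paired G w → ∃ λ M → length w ≡ M * 2
  paired-length []       = 0 , refl
  paired-length (_ ∷ pw) = let (M , len) = paired-length pw in suc M , cong (2 +_) len

  pair-at : ∀ {w} → Paired G w → ∀ h (i j : Fin (length w))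
    → toℕ i ≡ h * 2 → toℕ j ≡ suc (h * 2) → G (lookup w i) (lookup w j)
  pair-at (gab ∷ _)  zero    zero          (suc zero)    _  _  = gab
  pair-at (_ ∷ pw)   (suc h) (suc (suc i)) (suc (suc j)) ei ej =
    pair-at pw h i j (suc-injective (suc-injective ei)) (suc-injective (suc-injective ej))
  pair-at (_ ∷ _)    zero    zero          zero          _  ()
  pair-at (_ ∷ _)    zero    zero          (suc (suc _)) _  ()
  pair-at (_ ∷ _)    zero    (suc _)       _             () _
  pair-at (_ ∷ _)    (suc _) zero          _             () _
  pair-at (_ ∷ _)    (suc _) (suc zero)    _             () _
  pair-at (_ ∷ _)    (suc _) (suc (suc _)) zero          _  ()
  pair-at (_ ∷ _)    (suc _) (suc (suc _)) (suc zero)    _  ()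

pair-slots : ∀ t M → (t * 2) % (suc M * 2) ≡ (t % suc M) * 2
                   × suc (t * 2) % (suc M * 2) ≡ suc ((t % suc M) * 2)
pair-slots t M = even , odd
  where
  open ≡-Reasoning
  L = suc M * 2
  even : (t * 2) % L ≡ (t % suc M) * 2
  even = sym (m%n*o≡m*o%[n*o] t (suc M) 2)
  odd : suc (t * 2) % L ≡ suc ((t % suc M) * 2)
  odd = begin
    suc (t * 2) % L       ≡⟨ cong (_% L) (+-comm 1 (t * 2)) ⟩
    (t * 2 + 1) % L       ≡⟨ [m*n+o]%[p*n]≡[m*n]%[p*n]+o t (suc M) (n<1+n 1) ⟩
    (t * 2) % L + 1       ≡⟨ cong (_+ 1) even ⟩
    (t % suc M) * 2 + 1   ≡⟨ +-comm _ 1 ⟩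
    suc ((t % suc M) * 2) ∎

Guarded : ∀ {n} → (Fin n → Fin n → Fin n → Set) → Letter n → Letter n → Set
Guarded P a b = ∀ {x y z} → Δ x a y → Δ y b z → P x y z

paired-run : ∀ {n} {P : Fin n → Fin n → Fin n → Set} w → Paired (Guarded P) w
  → ∀ {ρ} → IsRun (w ^ω) ρ → ∀ t → P (ρ (t * 2)) (ρ (suc (t * 2))) (ρ (suc t * 2))
paired-run [] _ run t with run 0
... | ()
paired-run w@(_ ∷ _) pw run t with paired-length pw
... | suc M , len =
  pair-at pw (t % suc M) ((t * 2) mod length w) (suc (t * 2) mod length w)
          (slot (t * 2) (proj₁ (pair-slots t M))) (slot (suc (t * 2)) (proj₂ (pair-slots t M)))
          (run (t * 2)) (run (suc (t * 2)))
  where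
  slot : ∀ m {r} → m % (suc M * 2) ≡ r → toℕ (m mod length w) ≡ r
  slot m m%≡r = trans (toℕ-fromℕ< _) (trans (%-congʳ {o = m} len) m%≡r)

StableFrom : ∀ {A : Set} → (ℕ → A) → ℕ → Set
StableFrom σ t = ∀ d → σ (d + t) ≡ σ t

-- A sequence that at every step either keeps its value or strictly decreases
-- in rank cannot avoid becoming stable (well-foundedness of ℕ, stated in the
-- constructively valid double-negated form).
eventually-stable : ∀ {A : Set} (rank : A → ℕ) (σ : ℕ → A)
  → (∀ t → rank (σ (suc t)) < rank (σ t) ⊎ σ (suc t) ≡ σ t)
  → ¬ (∀ t → ¬ StableFrom σ t)
eventually-stable rank σ settles never = below (suc (rank (σ 0))) 0 ≤-refl
  where
  below : ∀ b t → rank (σ t) < b → ⊥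
  below (suc b) t (s≤s rank≤b) = never t stays
    where
    stays : StableFrom σ t
    stays zero    = refl
    stays (suc d) with settles (d + t)
    ... | inj₂ same = trans same (stays d)
    ... | inj₁ drop = ⊥-elim (below b (suc (d + t)) (<-≤-trans drop rank-at-d≤b))
      where
      rank-at-d≤b : rank (σ (d + t)) ≤ b
      rank-at-d≤b = subst (λ a → rank a ≤ b) (sym (stays d)) rank≤b

step-of : ∀ t m → t * 2 ≤ m → ∃ λ h → t ≤ h × (m ≡ h * 2 ⊎ m ≡ suc (h * 2))
step-of zero    zero          _  = 0 , z≤n , inj₁ refl
step-of zero    (suc zero)    _  = 0 , z≤n , inj₂ refl
step-of zero    (suc (suc m)) _  =
  let (h , _ , m≡) = step-of zero m z≤n in suc h , z≤n , Sum.map (cong (2 +_)) (cong (2 +_)) m≡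
step-of (suc t) (suc (suc m)) (s≤s (s≤s le)) =
  let (h , t≤h , m≡) = step-of t m le in suc h , s≤s t≤h , Sum.map (cong (2 +_)) (cong (2 +_)) m≡

module Descent {n k : ℕ} (F : Fin k → Subset n) (g : Fin n → Fin k) (f : Fin n → ℕ) where

  Descends : Fin n → Fin n → Fin n → Set
  Descends x y z = f z < f x ⊎ (z ≡ x × y ∉ F (g x))

  -- If no state lies in its own acceptance set, a run that descends at every
  -- even position is not successful: it settles at some x at even positions,
  -- and afterwards never visits F_{g(x)}.
  descending-run-rejected : (∀ x → x ∉ F (g x)) → ∀ {ρ : ℕ → Fin n}
    → (∀ t → Descends (ρ (t * 2)) (ρ (suc (t * 2))) (ρ (suc t * 2))) → ¬ Successful F ρ
  descending-run-rejected outside {ρ} descends success = eventually-stable f σ settles never-stable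
    where
    σ : ℕ → Fin n
    σ t = ρ (t * 2)
    settles : ∀ t → f (σ (suc t)) < f (σ t) ⊎ σ (suc t) ≡ σ t
    settles t = Sum.map₂ proj₁ (descends t)
    never-stable : ∀ t → ¬ StableFrom σ t
    never-stable t stable with success (g (σ t))
    ... | q , q∈F , infinitely with infinitely (t * 2)
    ... | m , 2t≤m , ρm≡q with step-of t m 2t≤m
    ... | h , t≤h , m≡ = visit m≡
      where
      x = σ t
      settled : ∀ {h} → t ≤ h → σ h ≡ x
      settled {h} t≤h = trans (cong σ (sym (m∸n+n≡m t≤h))) (stable (h ∸ t))
      σh≡x : σ h ≡ x
      σh≡x = settled t≤h
      visited : ρ m ∈ F (g x)
      visited = subst (_∈ F (g x)) (sym ρm≡q) q∈F
      visit : m ≡ h * 2 ⊎ m ≡ suc (h * 2) → ⊥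
      visit (inj₁ refl) = outside x (subst (_∈ F (g x)) σh≡x visited)
      visit (inj₂ refl) with descends h
      ... | inj₁ drop =
        <-irrefl refl (subst₂ _<_ (cong f (settled (m≤n⇒m≤1+n t≤h))) (cong f σh≡x) drop)
      ... | inj₂ (_ , y∉F) = subst (λ s → ρ m ∉ F (g s)) σh≡x y∉F visited

module Segment {n k : ℕ} (snf : Fin n) (F : Fin k → Subset n) (f : Fin n → ℕ) (g : Fin n → Fin k)
               (finv : ℕ → Fin n) (c : Fin k → Fin n → Fin n) (d : Fin n → Fin n)
               (snf-outside : ∀ i → snf ∉ F i)
               (ranked-outside : ∀ q → q ≢ snf → q ∉ F (g q))
               (finv-inverse : ∀ r → 1 ≤ r → r ≤ n ∸ 1 → finv r ≢ snf × f (finv r) ≡ r)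
               (c-spec : ∀ i p → p ≢ snf → i ≢ g p → c i p ∈ F i × c i p ∉ F (g p))
               (d-spec : ∀ p → p ≢ snf → d p ∈ F (g p)) where
  open Construction snf g finv c d
  open LetterShape snf g finv c d
  open Descent F g f

  not-snf : ∀ {i q} → q ∈ F i → q ≢ snf
  not-snf {i} q∈F refl = snf-outside i q∈F

  own-outside : ∀ x → x ∉ F (g x)
  own-outside x with x ≟ snf
  ... | yes refl  = snf-outside (g snf)
  ... | no x≢snf = ranked-outside x x≢snf

  return-outside : ∀ {x y} → y ≡ x ⊎ y ≡ snf → y ∉ F (g x)
  return-outside (inj₁ refl) = own-outside _
  return-outside {x} (inj₂ refl) = snf-outside (g x)

  -- The pair of u_r for index i goes p → c(i,p) → p, and c(i,p) ∉ F_{g(p)}.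
  u-part-paired : ∀ p → p ≢ snf → ∀ i → Paired (Guarded Descends) (uPart p i)
  u-part-paired p p≢snf i with i ≟ g p
  ... | yes _   = []
  ... | no i≢gp = guard ∷ []
    where
    s = c i p
    spec = c-spec i p p≢snf i≢gp
    R = (p , p) ∷ (s , s) ∷ []
    guard : Guarded Descends [+ (p , s) ∷ (s , snf) ∷ [] ,- R ] [+ (s , p) ∷ (snf , s) ∷ [] ,- R ]
    guard e₁ e₂ with detour {p} {s} {p} R R (not-snf (proj₁ spec))
                            (there (here refl)) (there (here refl)) e₁ e₂
    ... | inj₁ (refl , refl , refl) = inj₂ (refl , proj₂ spec)
    ... | inj₂ (z≡x , back)          = inj₂ (z≡x , return-outside back)

  u-paired : ∀ r → 1 ≤ r → r ≤ n ∸ 1 → Paired (Guarded Descends) (u r)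
  u-paired r 1≤r r≤n-1 =
    paired-concatMap (u-part-paired (finv r) (proj₁ (finv-inverse r 1≤r r≤n-1))) (allFin k)

  -- The pair of v_r goes from f⁻¹(r) to f⁻¹(r-1), lowering the rank.
  v-paired : ∀ r → suc (suc r) ≤ n ∸ 1 → Paired (Guarded Descends) (v (suc (suc r)))
  v-paired r r+2≤n-1 = guard ∷ []
    where
    p = finv (suc (suc r))
    q = finv (suc r)
    p-inverse = finv-inverse (suc (suc r)) (s≤s z≤n) r+2≤n-1
    q-inverse = finv-inverse (suc r) (s≤s z≤n) (<⇒≤ r+2≤n-1)
    s = d p
    R = (s , s) ∷ []
    guard : Guarded Descends [+ (p , s) ∷ (s , snf) ∷ [] ,- R ] [+ (s , q) ∷ (snf , s) ∷ [] ,- R ]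
    guard e₁ e₂ with detour {p} {s} {q} R R (not-snf (d-spec p (proj₁ p-inverse)))
                            (here refl) (here refl) e₁ e₂
    ... | inj₁ (refl , refl , refl) =
      inj₁ (subst₂ _<_ (sym (proj₂ q-inverse)) (sym (proj₂ p-inverse)) (n<1+n (suc r)))
    ... | inj₂ (z≡x , back)          = inj₂ (z≡x , return-outside back)

  seg-from-paired : ∀ r → r ≤ n ∸ 1 → Paired (Guarded Descends) (segFrom r)
  seg-from-paired zero          _         = []
  seg-from-paired (suc zero)    1≤n-1     = u-paired 1 (s≤s z≤n) 1≤n-1
  seg-from-paired (suc (suc r)) r+2≤n-1 =
    paired-++ (u-paired (suc (suc r)) (s≤s z≤n) r+2≤n-1)
              (paired-++ (v-paired r r+2≤n-1) (seg-from-paired (suc r) (<⇒≤ r+2≤n-1)))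

lemma5p8 : (n k : ℕ) → 1 < n → 1 < k → k ≤ (n ∸ 1) C ((n ∸ 1) / 2)
    → (snf : Fin n) (F : Fin k → Subset n) → IsStandardFull n k snf F
    → (f : Fin n → ℕ) (g : Fin n → Fin k) → IsPGCL n k snf F f g
    → (finv : ℕ → Fin n)
    → (∀ r → 1 ≤ r → r ≤ n ∸ 1 → finv r ≢ snf × f (finv r) ≡ r)
    → (c : Fin k → Fin n → Fin n)
    → (∀ i p → p ≢ snf → i ≢ g p → c i p ∈ F i × c i p ∉ F (g p))
    → (d : Fin n → Fin n)
    → (∀ p → p ≢ snf → d p ∈ F (g p))
    → ¬ Accepts F ((Construction.seg snf g finv c d) ^ω)
lemma5p8 n k _ _ _ snf F (_ , snf-outside , _ , _) f g (_ , _ , _ , ranked-outside)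
         finv finv-inverse c c-spec d d-spec (ρ , run , success) =
  descending-run-rejected own-outside (paired-run seg (seg-from-paired (n ∸ 1) ≤-refl) run) success
  where
  open Construction snf g finv c d using (seg)
  open Descent F g f using (descending-run-rejected)
  open Segment snf F f g finv c d snf-outside ranked-outside finv-inverse c-spec d-spec
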